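{- Let $w\in W$ be a nonempty word and $\mathsf{sw}(w)$ its special wave. Then $\mathsf{des}(w)=\mathsf{des}(w\setminus\mathsf{sw}(w))+\mathsf{des}(\mathsf{sw}(w))$.
   Context: $W$ is the set of all finite words of positive integers with pairwise distinct entries. For $u=u_1\cdots u_\ell$, $\mathsf{des}(u)=\#\{j\in[\ell-1]:u_j>u_{j+1}\}$ (and $\mathsf{des}$ of the empty word is $0$). Special wave: let $w=w_1\cdots w_\ell\in W$ be nonempty. If the entries of $w$ are increasing, $\mathsf{sw}(w)=w$ and $w\setminus\mathsf{sw}(w)$ is empty. Otherwise let $t$ be minimal with $w_t>w_{t+1}$; let $r$ be minimal with $1\le r\le t$ and $w_r>w_{t+1}$; set $w_0=0$ and let $s$ be maximal with $t<s\le\ell$ and $w_{t+1}>w_{t+2}>\cdots>w_s>w_{r-1}$. Then $\mathsf{sw}(w)=w_r\cdots w_s$ and $w\setminus\mathsf{sw}(w)=w_1\cdots w_{r-1}w_{s+1}\cdots w_\ell$. -}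

module Defs where

open import Data.Nat using (ℕ; zero; suc; _+_; _<_; _<ᵇ_)
open import Data.Bool using (Bool; true; false; if_then_else_; _∧_)
open import Data.List using (List; []; _∷_; _++_)
open import Data.Maybe using (Maybe; just; nothing)
import Data.Maybe
open import Data.Product using (_×_; _,_)
open import Data.List.Relation.Unary.All using (All)
open import Data.List.Relation.Unary.Unique.Propositional using (Unique)

InW : List ℕ → Set
InW w = All (λ x → 0 < x) w × Unique w

des : List ℕ → ℕ
des [] = 0
des (x ∷ []) = 0
des (x ∷ y ∷ xs) = (if y <ᵇ x then 1 else 0) + des (y ∷ xs)

-- First descent: w = P ++ y ∷ R, where P = w_1..w_t (t minimal with w_t > w_{t+1}),
-- y = w_{t+1}, R = w_{t+2}..w_ℓ.  nothing if w is increasing.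
firstDescent : List ℕ → Maybe (List ℕ × ℕ × List ℕ)
firstDescent [] = nothing
firstDescent (x ∷ []) = nothing
firstDescent (x ∷ y ∷ xs) =
  if y <ᵇ x then just (x ∷ [] , y , xs)
  else Data.Maybe.map (λ { (P , z , R) → (x ∷ P , z , R) }) (firstDescent (y ∷ xs))

-- splitR y last P = (A , b , B) with P = A ++ B, B starting at the first entry
-- w_r > y (r minimal), and b = w_{r-1} (the last entry of A, or `last` = w_0 = 0 if A empty).
splitR : ℕ → ℕ → List ℕ → List ℕ × ℕ × List ℕ
splitR y last [] = [] , last , []
splitR y last (x ∷ xs) with y <ᵇ x
... | true = [] , last , x ∷ xs
... | false with splitR y x xs
...   | (A , b , B) = x ∷ A , b , B

decRun : ℕ → ℕ → List ℕ → List ℕ × List ℕ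
decRun prev b [] = [] , []
decRun prev b (x ∷ xs) with (x <ᵇ prev) ∧ (b <ᵇ x)
... | true with decRun x b xs
...   | (D , R') = x ∷ D , R'
decRun prev b (x ∷ xs) | false = [] , x ∷ xs

swSplit : List ℕ → List ℕ × List ℕ
swSplit w with firstDescent w
... | nothing = w , []
... | just (P , y , R) with splitR y 0 P
...   | (A , b , B) with decRun y b R
...     | (D , R') = B ++ (y ∷ D) , A ++ R'

sw : List ℕ → List ℕ
sw w with swSplit w
... | (s , _) = s

swRest : List ℕ → List ℕ
swRest w with swSplit w
... | (_ , r) = r

-- Write w = A B y D R' with sw(w) = B y D: A B is the increasing prefix before
-- the first descent (into y), B starts at the first entry above y, and D is the
-- longest decreasing run after y staying above b, the last entry of A (or 0).
-- Since A B is increasing, the descents of w are the one into y, those inside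
-- y D and R', and the one from the end of y D into the first entry x of R'. The
-- first two kinds are exactly the descents of B y D. The junction is a descent
-- iff x < b, i.e. iff A R' has one at its junction: x stopped the run, so x > b
-- forces x above the end of y D, while x < b lies below it; x = b is ruled out
-- by distinctness and positivity.
module Submission where

open import Defs
open import Data.Nat using (ℕ; _+_)
open import Data.List using (List; [])
open import Relation.Binary.PropositionalEquality using (_≡_; _≢_)

open import Data.Bool using (true; false; if_then_else_; _∧_; T)
open import Data.Bool.Properties using (∧-identityʳ)
open import Data.Empty using (⊥-elim)
open import Data.List using (_∷_; _++_)
open import Data.List.Properties using (++-assoc; ++-identityʳ)
open import Data.List.Relation.Unary.All as All using (All; _∷_)
open import Data.List.Relation.Unary.All.Properties using (++⁻ʳ)
open import Data.List.Relation.Unary.AllPairs using (_∷_)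
open import Data.List.Relation.Unary.Unique.Propositional using (Unique)
open import Data.Maybe using (just; nothing)
open import Data.Nat using (suc; _<_; _≤_; _<ᵇ_; z≤n)
open import Data.Nat.Properties
  using (_<?_; <ᵇ⇒<; <⇒<ᵇ; <-cmp; <-trans; <⇒≯; <-asym; +-suc; <⇒≢; ≮⇒≥; ≤∧≢⇒<; +-assoc; +-comm; m+n≡0⇒m≡0; m+n≡0⇒n≡0)
open import Data.Product using (_×_; _,_; ∃-syntax; proj₁; proj₂)
open import Function using (id)
open import Relation.Binary using (tri<; tri≈; tri>)
open import Relation.Binary.PropositionalEquality using (refl; sym; trans; cong; cong₂; subst; module ≡-Reasoning)
open import Relation.Nullary using (¬_)
open import Relation.Nullary.Decidable using (dec-true; dec-false)

<⇒<ᵇ≡true : ∀ {m n} → m < n → (m <ᵇ n) ≡ true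
<⇒<ᵇ≡true {m} {n} = dec-true (m <? n)

≮⇒<ᵇ≡false : ∀ {m n} → ¬ m < n → (m <ᵇ n) ≡ false
≮⇒<ᵇ≡false {m} {n} = dec-false (m <? n)

<ᵇ≡true⇒< : ∀ {m n} → (m <ᵇ n) ≡ true → m < n
<ᵇ≡true⇒< {m} {n} e = <ᵇ⇒< m n (subst T (sym e) _)

<ᵇ≡false⇒≮ : ∀ {m n} → (m <ᵇ n) ≡ false → ¬ m < n
<ᵇ≡false⇒≮ e m<n = subst T e (<⇒<ᵇ m<n)

-- desFrom p xs = des (p ∷ xs), in a form that splits cleanly over _++_.
desFrom : ℕ → List ℕ → ℕ
desFrom p []       = 0
desFrom p (x ∷ xs) = (if x <ᵇ p then 1 else 0) + desFrom x xs

lastOr : ℕ → List ℕ → ℕ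
lastOr p []       = p
lastOr p (x ∷ xs) = lastOr x xs

des≡desFrom0 : ∀ w → des w ≡ desFrom 0 w
des≡desFrom0 []           = refl
des≡desFrom0 (x ∷ [])     = refl
des≡desFrom0 (x ∷ y ∷ xs) = cong ((if y <ᵇ x then 1 else 0) +_) (des≡desFrom0 (y ∷ xs))

desFrom-++ : ∀ p xs ys → desFrom p (xs ++ ys) ≡ desFrom p xs + desFrom (lastOr p xs) ys
desFrom-++ p []       ys = refl
desFrom-++ p (x ∷ xs) ys =
  trans (cong ((if x <ᵇ p then 1 else 0) +_) (desFrom-++ x xs ys))
        (sym (+-assoc (if x <ᵇ p then 1 else 0) (desFrom x xs) _))

lastOr-++ : ∀ p xs ys → lastOr p (xs ++ ys) ≡ lastOr (lastOr p xs) ys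
lastOr-++ p []       ys = refl
lastOr-++ p (x ∷ xs) ys = lastOr-++ x xs ys

firstDescent-cons : ∀ x xs {P y R} → firstDescent (x ∷ xs) ≡ just (P , y , R) →
  ∃[ P' ] P ≡ x ∷ P' × xs ≡ P' ++ y ∷ R × desFrom x P' ≡ 0 × y < lastOr x P'
firstDescent-cons x []       ()
firstDescent-cons x (z ∷ xs) eq with z <ᵇ x in z<ᵇx
firstDescent-cons x (z ∷ xs) refl | true = [] , refl , refl , refl , <ᵇ≡true⇒< z<ᵇx
... | false with firstDescent (z ∷ xs) in fd
firstDescent-cons x (z ∷ xs) refl | false | just (Q , y , R)
  with firstDescent-cons z xs fd
... | Q' , refl , refl , incQ' , y<last =
  z ∷ Q' , refl , refl , trans (cong (λ c → (if c then 1 else 0) + desFrom z Q') z<ᵇx) incQ' , y<last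

firstDescent-just : ∀ w {P y R} → firstDescent w ≡ just (P , y , R) →
  w ≡ P ++ y ∷ R × desFrom 0 P ≡ 0 × y < lastOr 0 P
firstDescent-just (x ∷ xs) fd with firstDescent-cons x xs fd
... | P' , refl , refl , inc , y<last = refl , inc , y<last

splitR-spec : ∀ y l P {A b B} → splitR y l P ≡ (A , b , B) →
  P ≡ A ++ B × b ≡ lastOr l A × (l ≤ y → b ≤ y)
splitR-spec y l []       refl = refl , refl , id
splitR-spec y l (x ∷ xs) eq with y <ᵇ x in y<ᵇx
splitR-spec y l (x ∷ xs) refl | true = refl , refl , id
... | false with splitR y x xs in sr
splitR-spec y l (x ∷ xs) refl | false | (A , b , B) with splitR-spec y x xs sr
... | refl , b≡last , b≤y = refl , b≡last , λ _ → b≤y (≮⇒≥ (<ᵇ≡false⇒≮ y<ᵇx))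

∧≡true⇒ʳ : ∀ {c d} → (c ∧ d) ≡ true → d ≡ true
∧≡true⇒ʳ {true} d≡true = d≡true

run-exit-descent : ∀ {b p x} → b < p → x ≢ b → ((x <ᵇ p) ∧ (b <ᵇ x)) ≡ false → (x <ᵇ p) ≡ (x <ᵇ b)
run-exit-descent {b} {p} {x} b<p x≢b stop with <-cmp x b
... | tri< x<b _ _ = trans (<⇒<ᵇ≡true (<-trans x<b b<p)) (sym (<⇒<ᵇ≡true x<b))
... | tri≈ _ x≡b _ = ⊥-elim (x≢b x≡b)
... | tri> _ _ b<x = begin
  x <ᵇ p                ≡⟨ sym (∧-identityʳ (x <ᵇ p)) ⟩
  (x <ᵇ p) ∧ true       ≡⟨ cong ((x <ᵇ p) ∧_) (sym (<⇒<ᵇ≡true b<x)) ⟩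
  (x <ᵇ p) ∧ (b <ᵇ x)   ≡⟨ stop ⟩
  false                 ≡⟨ sym (≮⇒<ᵇ≡false (<⇒≯ b<x)) ⟩
  x <ᵇ b                ∎
  where open ≡-Reasoning

decRun-++ : ∀ p b R {D R'} → decRun p b R ≡ (D , R') → R ≡ D ++ R'
decRun-++ p b []       refl = refl
decRun-++ p b (x ∷ xs) eq with (x <ᵇ p) ∧ (b <ᵇ x)
... | true with decRun x b xs in dr
decRun-++ p b (x ∷ xs) refl | true | (D , R') = cong (x ∷_) (decRun-++ x b xs dr)
decRun-++ p b (x ∷ xs) refl | false = refl

decRun-exit : ∀ p b R {D R'} → b < p → All (b ≢_) R → decRun p b R ≡ (D , R') →
  desFrom (lastOr p D) R' ≡ desFrom b R'
decRun-exit p b []       _   _                  refl = refl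
decRun-exit p b (x ∷ xs) b<p (b≢x ∷ b∉xs) eq with (x <ᵇ p) ∧ (b <ᵇ x) in continues
... | true with decRun x b xs in dr
decRun-exit p b (x ∷ xs) b<p (b≢x ∷ b∉xs) refl | true | (D , R') =
  decRun-exit x b xs (<ᵇ≡true⇒< (∧≡true⇒ʳ continues)) b∉xs dr
decRun-exit p b (x ∷ xs) b<p (b≢x ∷ b∉xs) refl | false =
  cong (λ c → (if c then 1 else 0) + desFrom x xs) (run-exit-descent b<p (λ x≡b → b≢x (sym x≡b)) continues)

desFrom-++-≡0 : ∀ p xs ys → desFrom p (xs ++ ys) ≡ 0 →
  desFrom p xs ≡ 0 × desFrom (lastOr p xs) ys ≡ 0
desFrom-++-≡0 p xs ys inc =
  m+n≡0⇒m≡0 (desFrom p xs) split , m+n≡0⇒n≡0 (desFrom p xs) split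
  where split = trans (sym (desFrom-++ p xs ys)) inc

unique-lastOr : ∀ a A C → Unique (a ∷ A ++ C) → All (lastOr a A ≢_) C
unique-lastOr a []       C (a∉C ∷ _) = a∉C
unique-lastOr a (a' ∷ A) C (_ ∷ u)   = unique-lastOr a' A C u

-- The sentinel w₀ = 0 is fresh too, since the entries of a word in W are positive.
lastOr0-fresh : ∀ A C → InW (A ++ C) → All (lastOr 0 A ≢_) C
lastOr0-fresh []      C (positive , _) = All.map <⇒≢ positive
lastOr0-fresh (a ∷ A) C (_ , unique)   = unique-lastOr a A C unique

des-cut : ∀ A B y D R' →
  desFrom 0 (A ++ B) ≡ 0 → y < lastOr 0 (A ++ B) → lastOr 0 A < y →
  desFrom (lastOr y D) R' ≡ desFrom (lastOr 0 A) R' →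
  des ((A ++ B) ++ y ∷ D ++ R') ≡ des (A ++ R') + des (B ++ y ∷ D)
des-cut A [] y D R' _ y<last b<y _ =
  ⊥-elim (<-asym b<y (subst (λ Q → y < lastOr 0 Q) (++-identityʳ A) y<last))
des-cut A (h ∷ t) y D R' inc y<last b<y exit = begin
  des ((A ++ h ∷ t) ++ y ∷ D ++ R')
    ≡⟨ des≡desFrom0 ((A ++ h ∷ t) ++ y ∷ D ++ R') ⟩
  desFrom 0 ((A ++ h ∷ t) ++ y ∷ D ++ R')
    ≡⟨ desFrom-++ 0 (A ++ h ∷ t) _ ⟩
  desFrom 0 (A ++ h ∷ t) + desFrom (lastOr 0 (A ++ h ∷ t)) (y ∷ D ++ R')
    ≡⟨ cong₂ _+_ inc (cong (λ c → (if c then 1 else 0) + desFrom y (D ++ R')) (<⇒<ᵇ≡true y<last)) ⟩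
  1 + desFrom y (D ++ R')
    ≡⟨ cong suc (desFrom-++ y D R') ⟩
  1 + (desFrom y D + desFrom (lastOr y D) R')
    ≡⟨ cong (λ k → 1 + (desFrom y D + k)) exit ⟩
  1 + (desFrom y D + desFrom b R')
    ≡⟨ cong suc (+-comm (desFrom y D) _) ⟩
  1 + (desFrom b R' + desFrom y D)
    ≡⟨ sym (+-suc (desFrom b R') _) ⟩
  desFrom b R' + (1 + desFrom y D)
    ≡⟨ sym (cong₂ _+_ des-rest des-wave) ⟩
  des (A ++ R') + des ((h ∷ t) ++ y ∷ D) ∎
  where
  open ≡-Reasoning
  b : ℕ
  b = lastOr 0 A
  incA : desFrom 0 A ≡ 0
  incA = proj₁ (desFrom-++-≡0 0 A (h ∷ t) inc)
  inc-t : desFrom h t ≡ 0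
  inc-t = m+n≡0⇒n≡0 (if h <ᵇ b then 1 else 0) (proj₂ (desFrom-++-≡0 0 A (h ∷ t) inc))
  y<last-t : y < lastOr h t
  y<last-t = subst (y <_) (lastOr-++ 0 A (h ∷ t)) y<last
  des-rest : des (A ++ R') ≡ desFrom b R'
  des-rest = begin
    des (A ++ R')                      ≡⟨ des≡desFrom0 (A ++ R') ⟩
    desFrom 0 (A ++ R')                ≡⟨ desFrom-++ 0 A R' ⟩
    desFrom 0 A + desFrom b R'         ≡⟨ cong (_+ desFrom b R') incA ⟩
    desFrom b R'                       ∎
  des-wave : des ((h ∷ t) ++ y ∷ D) ≡ 1 + desFrom y D
  des-wave = begin
    des ((h ∷ t) ++ y ∷ D)
      ≡⟨ des≡desFrom0 (h ∷ t ++ y ∷ D) ⟩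
    desFrom h (t ++ y ∷ D)
      ≡⟨ desFrom-++ h t (y ∷ D) ⟩
    desFrom h t + ((if y <ᵇ lastOr h t then 1 else 0) + desFrom y D)
      ≡⟨ cong₂ (λ i c → i + ((if c then 1 else 0) + desFrom y D)) inc-t (<⇒<ᵇ≡true y<last-t) ⟩
    1 + desFrom y D
      ∎

proposition6p8 : (w : List ℕ) → InW w → w ≢ [] →
    des w ≡ des (swRest w) + des (sw w)
proposition6p8 w w∈W _ with firstDescent w in fd
... | nothing = refl
... | just (P , y , R) with firstDescent-just w fd
... | refl , inc , y<last with splitR y 0 P in sr
... | (A , b , B) with splitR-spec y 0 P sr
... | refl , refl , b≤y with decRun y b R in dr
... | (D , R') with decRun-++ y b R dr
... | refl = des-cut A B y D R' inc y<last b<y (decRun-exit y b R b<y b∉R dr)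
  where
  fresh : All (lastOr 0 A ≢_) (y ∷ D ++ R')
  fresh = ++⁻ʳ B (lastOr0-fresh A (B ++ y ∷ D ++ R') (subst InW (++-assoc A B _) w∈W))
  b<y : lastOr 0 A < y
  b<y = ≤∧≢⇒< (b≤y z≤n) (All.head fresh)
  b∉R : All (lastOr 0 A ≢_) (D ++ R')
  b∉R = All.tail fresh
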